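{- Let $\mathbb{I}$ be an interval satisfying the $n$-dimensional Phoa principle for all $n\le2$. Then a type $X$ is Rezk complete if and only if $L(X)$ is Rezk complete.
   Context: Homotopy type theory. An interval is a set $\mathbb{I}$ with bounded meet-semilattice structure $(0,1,\sqcap)$, $i\sqsubseteq j$ meaning $i\sqcap j=i$; $[\![i]\!]:\equiv(i=1)$; $L(X):\equiv\sum_{i:\mathbb{I}}X^{[\![i]\!]}$. $\Delta^n:\equiv\{(i_1,\dots,i_n)\mid i_1\sqsupseteq\dots\sqsupseteq i_n\}$ ($\Delta^0=\mathbf1$, $\Delta^1=\mathbb{I}$, $\Delta^2=\{(j\sqsupseteq i)\}$). $n$-dimensional Phoa principle: every function $\Delta^n\to\mathbb{I}$ is monotone (componentwise order), and any two functions $\Delta^n\to\mathbb{I}$ agreeing on the vertices $(1^k,0^{n-k})$, $0\le k\le n$, are equal. The walking equivalence $\mathbb{E}$ is the colimit of $\Delta^0\leftarrow\Delta^1\to\Delta^2\leftarrow\Delta^1\to\Delta^2\leftarrow\Delta^1\to\Delta^0$, with outer maps $\Delta^1\to\Delta^0$ terminal, outer $\Delta^1\to\Delta^2$ given by $i\mapsto(i\sqsupseteq i)$, and the middle $\Delta^1$ mapping to the first $\Delta^2$ by $i\mapsto(i\sqsupseteq0)$ and to the second by $i\mapsto(1\sqsupseteq i)$. A type $X$ is Rezk complete if precomposition with $\mathbb{E}\to\mathbf1$, $X\to X^{\mathbb{E}}$, is an equivalence. -}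

{-# OPTIONS --without-K #-}
module Defs where

open import Level using (Level; _⊔_; suc; Lift; lift)
open import Data.Unit using (⊤; tt)
open import Data.Nat using (ℕ; zero) renaming (suc to sucℕ)
open import Data.Fin using (Fin) renaming (zero to fzero; suc to fsuc)
open import Data.Product using (Σ; _×_; _,_; proj₁; proj₂)
open import Relation.Binary.PropositionalEquality using (_≡_; refl; trans)

isContr : ∀ {ℓ} → Set ℓ → Set ℓ
isContr A = Σ A λ c → ∀ x → c ≡ x

isProp : ∀ {ℓ} → Set ℓ → Set ℓ
isProp A = (x y : A) → x ≡ y

isSet : ∀ {ℓ} → Set ℓ → Set ℓ
isSet A = (x y : A) → isProp (x ≡ y)

fiber : ∀ {ℓ ℓ'} {A : Set ℓ} {B : Set ℓ'} → (A → B) → B → Set (ℓ ⊔ ℓ')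
fiber {A = A} f b = Σ A λ a → f a ≡ b

isEquiv : ∀ {ℓ ℓ'} {A : Set ℓ} {B : Set ℓ'} → (A → B) → Set (ℓ ⊔ ℓ')
isEquiv {B = B} f = (b : B) → isContr (fiber f b)

record Interval (a : Level) : Set (suc a) where
  infixl 7 _⊓_
  field
    𝕀     : Set a
    𝕀-set : isSet 𝕀
    0I 1I : 𝕀
    _⊓_   : 𝕀 → 𝕀 → 𝕀
    ⊓-assoc : ∀ x y z → (x ⊓ y) ⊓ z ≡ x ⊓ (y ⊓ z)
    ⊓-comm  : ∀ x y → x ⊓ y ≡ y ⊓ x
    ⊓-idem  : ∀ x → x ⊓ x ≡ x
    ⊓-1     : ∀ x → x ⊓ 1I ≡ x
    ⊓-0     : ∀ x → x ⊓ 0I ≡ 0I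

  _⊑_ : 𝕀 → 𝕀 → Set a
  i ⊑ j = i ⊓ j ≡ i

  ⟦_⟧ : 𝕀 → Set a
  ⟦ i ⟧ = i ≡ 1I

  L : ∀ {ℓ} → Set ℓ → Set (a ⊔ ℓ)
  L X = Σ 𝕀 λ i → ⟦ i ⟧ → X

  -- Δⁿ = {(i₁,…,iₙ) | i₁ ⊒ … ⊒ iₙ}, defined by recursion together with
  -- the first coordinate hd.  Δ 0 = 1, Δ 1 = 𝕀, Δ 2 = {(j , i) | j ⊒ i}.
  mutual
    Δ : ℕ → Set a
    Δ zero = Lift a ⊤
    Δ (sucℕ zero) = 𝕀
    Δ (sucℕ (sucℕ n)) = Σ (𝕀 × Δ (sucℕ n)) λ p → hd {n} (proj₂ p) ⊑ proj₁ p

    hd : ∀ {n} → Δ (sucℕ n) → 𝕀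
    hd {zero} i = i
    hd {sucℕ n} ((i , _) , _) = i

  _≤Δ_ : ∀ {n} → Δ n → Δ n → Set a
  _≤Δ_ {zero} _ _ = Lift a ⊤
  _≤Δ_ {sucℕ zero} i j = i ⊑ j
  _≤Δ_ {sucℕ (sucℕ n)} ((i , x) , _) ((j , y) , _) = (i ⊑ j) × (_≤Δ_ {sucℕ n} x y)

  -- IsVertex n k x : x is the vertex (1^k, 0^(n-k)),  0 ≤ k ≤ n
  IsVertex : (n : ℕ) → Fin (sucℕ n) → Δ n → Set a
  IsVertex zero fzero _ = Lift a ⊤
  IsVertex (sucℕ zero) fzero i = i ≡ 0I
  IsVertex (sucℕ zero) (fsuc fzero) i = i ≡ 1I
  IsVertex (sucℕ (sucℕ n)) fzero ((i , x) , _) = (i ≡ 0I) × IsVertex (sucℕ n) fzero x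
  IsVertex (sucℕ (sucℕ n)) (fsuc k) ((i , x) , _) = (i ≡ 1I) × IsVertex (sucℕ n) k x

  record Phoa (n : ℕ) : Set a where
    field
      monotone  : (f : Δ n → 𝕀) (x y : Δ n) → _≤Δ_ {n} x y → f x ⊑ f y
      vertexDet : (f g : Δ n → 𝕀) →
                  ((k : Fin (sucℕ n)) (x : Δ n) → IsVertex n k x → f x ≡ g x) →
                  (x : Δ n) → f x ≡ g x

  -- The walking equivalence 𝔼, via maps out of it (cocones over the zigzag
  -- Δ⁰ ← Δ¹ → Δ² ← Δ¹ → Δ² ← Δ¹ → Δ⁰).

  diag : 𝕀 → Δ 2
  diag i = (i , i) , ⊓-idem i

  bot : 𝕀 → Δ 2
  bot i = (i , 0I) , trans (⊓-comm 0I i) (⊓-0 i)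

  top : 𝕀 → Δ 2
  top i = (1I , i) , ⊓-1 i

  _^𝔼 : ∀ {ℓ} → Set ℓ → Set (a ⊔ ℓ)
  X ^𝔼 = Σ X λ x₀ → Σ (Δ 2 → X) λ f → Σ (Δ 2 → X) λ g → Σ X λ x₃ →
           ((i : 𝕀) → x₀ ≡ f (diag i))
         × ((i : 𝕀) → f (bot i) ≡ g (top i))
         × ((i : 𝕀) → g (diag i) ≡ x₃)

  -- precomposition with 𝔼 → 1
  const𝔼 : ∀ {ℓ} (X : Set ℓ) → X → X ^𝔼
  const𝔼 X x = x , (λ _ → x) , (λ _ → x) , x , (λ _ → refl) , (λ _ → refl) , (λ _ → refl)

  RezkComplete : ∀ {ℓ} → Set ℓ → Set (a ⊔ ℓ)
  RezkComplete X = isEquiv (const𝔼 X)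

{-# OPTIONS --safe --without-K #-}
-- Rezk completeness of X amounts to every cocone c : X ^𝔼 being equal to the
-- constant cocone at its first point.  This property holds for propositions,
-- is closed under Σ-types, exponentials and retracts, and holds for 𝕀 by the
-- Phoa principle: a map Δ² → 𝕀 constant on the diagonal is constant.  Hence
-- L X = Σ (i : 𝕀) (⟦ i ⟧ → X) inherits it from X; conversely X is a retract
-- of the type Σ (y : L X) ⟦ proj₁ y ⟧ of defined elements of L X.
module Submission where

open import Defs
open import Level using (Level; _⊔_)
open import Data.Nat using (ℕ; _≤_; z≤n; s≤s)
open import Data.Fin using (Fin) renaming (zero to fzero; suc to fsuc)
open import Data.Product using (_×_; Σ; _,_; proj₁; proj₂)
open import Data.Product.Properties using (Σ-≡,≡→≡)
open import Function using (id; _∘_)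
open import Axiom.Extensionality.Propositional using (Extensionality)
open import Axiom.UniquenessOfIdentityProofs using (module Constant⇒UIP)
open import Relation.Binary.PropositionalEquality
open import Relation.Binary.PropositionalEquality.Properties
  using (trans-symˡ; cong-id; cong-∘)

isProp⇒isSet : ∀ {ℓ} {A : Set ℓ} → isProp A → isSet A
isProp⇒isSet A-prop _ _ = Constant⇒UIP.≡-irrelevant (λ {x} {y} _ → A-prop x y) (λ _ _ → refl)

module RezkCompleteness {a : Level} (I : Interval a) where
  open Interval I

  ConstantCocones : ∀ {ℓ} → Set ℓ → Set (a ⊔ ℓ)
  ConstantCocones X = (c : X ^𝔼) → const𝔼 X (proj₁ c) ≡ c

  module _ {ℓ} {X : Set ℓ} where

    rezk⇒constantCocones : RezkComplete X → ConstantCocones X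
    rezk⇒constantCocones rezk c with proj₁ (rezk c)
    ... | _ , refl = refl

    constantCocones⇒rezk : ConstantCocones X → RezkComplete X
    constantCocones⇒rezk X-const c = (proj₁ c , normalised c) , λ (x , e) → unique x e
      where
      -- normalised is refl on constant cocones, which makes it the centre of contraction
      normalised : ConstantCocones X
      normalised c = trans (sym (X-const (const𝔼 X (proj₁ c)))) (X-const c)

      unique : ∀ {c} x (e : const𝔼 X x ≡ c) →
               _≡_ {A = fiber (const𝔼 X) c} (proj₁ c , normalised c) (x , e)
      unique x refl = cong (x ,_) (trans-symˡ (X-const (const𝔼 X x)))

    cocone-≡ : {x : X} {f g : Δ 2 → X} {x₃ : X}
      {p p′ : (i : 𝕀) → x ≡ f (diag i)} {q q′ : (i : 𝕀) → f (bot i) ≡ g (top i)}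
      {r r′ : (i : 𝕀) → g (diag i) ≡ x₃} → p ≡ p′ → q ≡ q′ → r ≡ r′ →
      _≡_ {A = X ^𝔼} (x , f , g , x₃ , p , q , r) (x , f , g , x₃ , p′ , q′ , r′)
    cocone-≡ refl refl refl = refl

  map𝔼 : ∀ {ℓ ℓ′} {X : Set ℓ} {Y : Set ℓ′} → (X → Y) → X ^𝔼 → Y ^𝔼
  map𝔼 h (x , f , g , x₃ , p , q , r) =
    h x , h ∘ f , h ∘ g , h x₃ , cong h ∘ p , cong h ∘ q , cong h ∘ r

  ⊑-antisym : ∀ {x y} → x ⊑ y → y ⊑ x → x ≡ y
  ⊑-antisym {x} {y} x⊑y y⊑x = trans (sym x⊑y) (trans (⊓-comm x y) y⊑x)

  0⊑1 : 0I ⊑ 1I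
  0⊑1 = ⊓-1 0I

  Δ²-≡ : ∀ {j i} (u v : i ⊑ j) → _≡_ {A = Δ 2} ((j , i) , u) ((j , i) , v)
  Δ²-≡ u v = cong (_ ,_) (𝕀-set _ _ u v)

  module _ (phoa : Phoa 2) where
    open Phoa phoa

    constant-on-diag⇒constant : (f : Δ 2 → 𝕀) (x : 𝕀) → (∀ i → f (diag i) ≡ x) →
                                ∀ d → f d ≡ x
    constant-on-diag⇒constant f x f-diag = vertexDet f (λ _ → x) at-vertex
      where
      -- by monotonicity, f (1 , 0) lies between f (0 , 0) and f (1 , 1)
      at-10 : (u : 0I ⊑ 1I) → f ((1I , 0I) , u) ≡ x
      at-10 u = ⊑-antisym
        (subst (f ((1I , 0I) , u) ⊑_) (f-diag 1I)
          (monotone f ((1I , 0I) , u) (diag 1I) (⊓-idem 1I , 0⊑1)))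
        (subst (_⊑ f ((1I , 0I) , u)) (f-diag 0I)
          (monotone f (diag 0I) ((1I , 0I) , u) (0⊑1 , ⊓-idem 0I)))

      at-vertex : (k : Fin 3) (d : Δ 2) → IsVertex 2 k d → f d ≡ x
      at-vertex fzero (_ , u) (refl , refl) = trans (cong f (Δ²-≡ u _)) (f-diag 0I)
      at-vertex (fsuc fzero) (_ , u) (refl , refl) = at-10 u
      at-vertex (fsuc (fsuc fzero)) (_ , u) (refl , refl) = trans (cong f (Δ²-≡ u _)) (f-diag 1I)

  module _ (ext : ∀ {u v : Level} → Extensionality u v) where

    module _ {ℓ} {X : Set ℓ} where

      map𝔼-id : (c : X ^𝔼) → map𝔼 id c ≡ c
      map𝔼-id (_ , _ , _ , _ , p , q , r) =
        cocone-≡ (ext (cong-id ∘ p)) (ext (cong-id ∘ q)) (ext (cong-id ∘ r))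

      map𝔼-∘ : ∀ {ℓ′ ℓ″} {Y : Set ℓ′} {Z : Set ℓ″} {h : Y → Z} {k : X → Y} (c : X ^𝔼) →
               map𝔼 (h ∘ k) c ≡ map𝔼 h (map𝔼 k c)
      map𝔼-∘ (_ , _ , _ , _ , p , q , r) =
        cocone-≡ (ext (cong-∘ ∘ p)) (ext (cong-∘ ∘ q)) (ext (cong-∘ ∘ r))

      retract-constantCocones : ∀ {ℓ′} {Y : Set ℓ′} (s : X → Y) (r : Y → X) →
        (∀ x → r (s x) ≡ x) → ConstantCocones Y → ConstantCocones X
      retract-constantCocones s r r∘s~id Y-const c = begin
        const𝔼 X (proj₁ c)                    ≡⟨ cong (λ h → map𝔼 h (const𝔼 X (proj₁ c))) (sym r∘s≡id) ⟩
        map𝔼 r (map𝔼 s (const𝔼 X (proj₁ c)))  ≡⟨ cong (map𝔼 r) (Y-const (map𝔼 s c)) ⟩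
        map𝔼 r (map𝔼 s c)                     ≡⟨ map𝔼-∘ c ⟨
        map𝔼 (r ∘ s) c                        ≡⟨ cong (λ h → map𝔼 h c) r∘s≡id ⟩
        map𝔼 id c                             ≡⟨ map𝔼-id c ⟩
        c                                     ∎
        where
        open ≡-Reasoning
        r∘s≡id : r ∘ s ≡ id
        r∘s≡id = ext r∘s~id

      set-constantCocones : isSet X → {x : X} {f g : Δ 2 → X} {x₃ : X}
        (p : (i : 𝕀) → x ≡ f (diag i)) (q : (i : 𝕀) → f (bot i) ≡ g (top i))
        (r : (i : 𝕀) → g (diag i) ≡ x₃) →
        (λ _ → x) ≡ f → (λ _ → x) ≡ g → x ≡ x₃ → const𝔼 X x ≡ (x , f , g , x₃ , p , q , r)
      set-constantCocones X-set p q r refl refl refl =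
        cocone-≡ (ext λ i → X-set _ _ refl (p i)) (ext λ i → X-set _ _ refl (q i))
                 (ext λ i → X-set _ _ refl (r i))

      prop-constantCocones : isProp X → ConstantCocones X
      prop-constantCocones X-prop (_ , _ , _ , _ , p , q , r) =
        set-constantCocones (isProp⇒isSet X-prop) p q r
          (ext λ _ → X-prop _ _) (ext λ _ → X-prop _ _) (X-prop _ _)

    module _ {α β} {A : Set α} (P : A → Set β) where

      DepCocone : A ^𝔼 → Set (a ⊔ β)
      DepCocone (a₀ , F , G , a₃ , p , q , r) =
        Σ (P a₀) λ u₀ → Σ ((d : Δ 2) → P (F d)) λ φ → Σ ((d : Δ 2) → P (G d)) λ ψ → Σ (P a₃) λ u₃ →
          ((i : 𝕀) → subst P (p i) u₀ ≡ φ (diag i))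
        × ((i : 𝕀) → subst P (q i) (φ (bot i)) ≡ ψ (top i))
        × ((i : 𝕀) → subst P (r i) (ψ (diag i)) ≡ u₃)

      pair𝔼 : (c : A ^𝔼) → DepCocone c → (Σ A P) ^𝔼
      pair𝔼 (a₀ , F , G , a₃ , p , q , r) (u₀ , φ , ψ , u₃ , p′ , q′ , r′) =
        (a₀ , u₀) , (λ d → F d , φ d) , (λ d → G d , ψ d) , (a₃ , u₃) ,
        (λ i → Σ-≡,≡→≡ (p i , p′ i)) , (λ i → Σ-≡,≡→≡ (q i , q′ i)) , (λ i → Σ-≡,≡→≡ (r i , r′ i))

      subst-proj₂ : {x y : Σ A P} (e : x ≡ y) → subst P (cong proj₁ e) (proj₂ x) ≡ proj₂ y
      subst-proj₂ refl = refl

      Σ-≡,≡→≡-η : {x y : Σ A P} (e : x ≡ y) → Σ-≡,≡→≡ (cong proj₁ e , subst-proj₂ e) ≡ e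
      Σ-≡,≡→≡-η refl = refl

      snd𝔼 : (c : (Σ A P) ^𝔼) → DepCocone (map𝔼 proj₁ c)
      snd𝔼 (x , f , g , x₃ , p , q , r) =
        proj₂ x , proj₂ ∘ f , proj₂ ∘ g , proj₂ x₃ ,
        subst-proj₂ ∘ p , subst-proj₂ ∘ q , subst-proj₂ ∘ r

      pair𝔼-η : (c : (Σ A P) ^𝔼) → pair𝔼 (map𝔼 proj₁ c) (snd𝔼 c) ≡ c
      pair𝔼-η (_ , _ , _ , _ , p , q , r) =
        cocone-≡ (ext (Σ-≡,≡→≡-η ∘ p)) (ext (Σ-≡,≡→≡-η ∘ q)) (ext (Σ-≡,≡→≡-η ∘ r))

      Σ-constantCocones : ConstantCocones A → (∀ x → ConstantCocones (P x)) →
                          ConstantCocones (Σ A P)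
      Σ-constantCocones A-const P-const c =
        trans (over-constant (A-const (map𝔼 proj₁ c)) (snd𝔼 c)) (pair𝔼-η c)
        where
        -- over a constant cocone, DepCocone (const𝔼 A a₀) is (P a₀) ^𝔼 on the nose
        over-constant : ∀ {a₀ c₁} → const𝔼 A a₀ ≡ c₁ → (dc : DepCocone c₁) →
                        const𝔼 (Σ A P) (proj₁ c₁ , proj₁ dc) ≡ pair𝔼 c₁ dc
        over-constant {a₀} refl dc = cong (pair𝔼 (const𝔼 A a₀)) (P-const a₀ dc)

    module _ {α ℓ} (A : Set α) {X : Set ℓ} where

      -- funext is normalised so that it sends the trivial homotopy to refl
      funext : {f g : A → X} → (∀ x → f x ≡ g x) → f ≡ g
      funext h = trans (sym (ext λ _ → refl)) (ext h)

      funext-refl : {f : A → X} → funext (λ x → refl {x = f x}) ≡ refl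
      funext-refl = trans-symˡ (ext λ _ → refl)

      funext-cong-app : {f g : A → X} (e : f ≡ g) → funext (λ x → cong (λ h → h x) e) ≡ e
      funext-cong-app refl = funext-refl

      Λ : (A → X ^𝔼) → (A → X) ^𝔼
      Λ c =
        (λ x → let (y , _) = c x in y) ,
        (λ d x → let (_ , f , _) = c x in f d) ,
        (λ d x → let (_ , _ , g , _) = c x in g d) ,
        (λ x → let (_ , _ , _ , y₃ , _) = c x in y₃) ,
        (λ i → funext λ x → let (_ , _ , _ , _ , p , _) = c x in p i) ,
        (λ i → funext λ x → let (_ , _ , _ , _ , _ , q , _) = c x in q i) ,
        (λ i → funext λ x → let (_ , _ , _ , _ , _ , _ , r) = c x in r i)

      Λ-map𝔼-eval : (c : (A → X) ^𝔼) → Λ (λ x → map𝔼 (λ h → h x) c) ≡ c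
      Λ-map𝔼-eval (_ , _ , _ , _ , p , q , r) =
        cocone-≡ (ext (funext-cong-app ∘ p)) (ext (funext-cong-app ∘ q)) (ext (funext-cong-app ∘ r))

      Λ-const : (y : A → X) → Λ (λ x → const𝔼 X (y x)) ≡ const𝔼 (A → X) y
      Λ-const y = cocone-≡ (ext λ _ → funext-refl) (ext λ _ → funext-refl) (ext λ _ → funext-refl)

      Π-constantCocones : ConstantCocones X → ConstantCocones (A → X)
      Π-constantCocones X-const c = begin
        const𝔼 (A → X) (proj₁ c)                 ≡⟨ Λ-const (proj₁ c) ⟨
        Λ (λ x → const𝔼 X (proj₁ c x))           ≡⟨ cong Λ (ext λ x → X-const (map𝔼 (λ h → h x) c)) ⟩
        Λ (λ x → map𝔼 (λ h → h x) c)             ≡⟨ Λ-map𝔼-eval c ⟩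
        c                                        ∎
        where open ≡-Reasoning

    𝕀-constantCocones : Phoa 2 → ConstantCocones 𝕀
    𝕀-constantCocones phoa (x , f , g , x₃ , p , q , r) =
      set-constantCocones 𝕀-set p q r
        (ext (sym ∘ f-const)) (ext λ d → sym (trans (g-const d) x₃≡x)) (sym x₃≡x)
      where
      f-const : ∀ d → f d ≡ x
      f-const = constant-on-diag⇒constant phoa f x (sym ∘ p)
      g-const : ∀ d → g d ≡ x₃
      g-const = constant-on-diag⇒constant phoa g x₃ r
      x₃≡x : x₃ ≡ x
      x₃≡x = trans (sym (g-const (top 1I))) (trans (sym (q 1I)) (f-const (bot 1I)))

    module _ {ℓ} {X : Set ℓ} where

      L-preserves-constantCocones : Phoa 2 → ConstantCocones X → ConstantCocones (L X)
      L-preserves-constantCocones phoa X-const =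
        Σ-constantCocones (λ i → ⟦ i ⟧ → X) (𝕀-constantCocones phoa)
          (λ i → Π-constantCocones ⟦ i ⟧ X-const)

      L-reflects-constantCocones : ConstantCocones (L X) → ConstantCocones X
      L-reflects-constantCocones LX-const =
        retract-constantCocones (λ x → (1I , λ _ → x) , refl) (λ ((_ , x) , w) → x w) (λ _ → refl)
          (Σ-constantCocones (⟦_⟧ ∘ proj₁) LX-const (λ _ → prop-constantCocones (𝕀-set _ _)))

lemmaV10 : ∀ {a ℓ : Level} → (∀ {u v : Level} → Extensionality u v) →
    (I : Interval a) → ((n : ℕ) → n ≤ 2 → Interval.Phoa I n) →
    (X : Set ℓ) →
    (Interval.RezkComplete I X → Interval.RezkComplete I (Interval.L I X))
    × (Interval.RezkComplete I (Interval.L I X) → Interval.RezkComplete I X)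
lemmaV10 ext I phoa X =
  (λ rezk → constantCocones⇒rezk (L-preserves-constantCocones ext (phoa 2 (s≤s (s≤s z≤n)))
                                     (rezk⇒constantCocones rezk))) ,
  (λ rezk → constantCocones⇒rezk (L-reflects-constantCocones ext (rezk⇒constantCocones rezk)))
  where open RezkCompleteness I
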